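{- Let $n\geq 1$ and $k$ be integers with $0\leq k\leq\frac n3$, and let $t\in\{0,\dots,n-1\}$. There is a function $f_t$, defined on multisets of $n-k$ unlabelled graphs on $n-1$ vertices and taking real values, such that for every graph $G$ on $n$ vertices and every choice of distinct vertices $v_1,\dots,v_{n-k}$ of $G$, the value $d_t^*=f_t(\{G-v_1,\dots,G-v_{n-k}\})$ satisfies $$\tfrac14d_t-1\leq d_t^*\leq d_{t-1}+d_t+d_{t+1},$$ where $d_s=d_s(G)$ (with $d_{ -1}=d_n=0$). That is, such a value $d_t^*$ can be calculated from any $n-k$ cards of $G$.
   Context: All graphs are finite, simple and undirected. For a graph $G'$, $d_s(G')$ denotes the number of vertices of degree $s$ in $G'$. The card $G-v$ is obtained from $G$ by deleting the vertex $v$ and all edges incident to it. -}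

module Defs where

open import Data.Nat using (ℕ; zero; suc; _+_; _*_; _∸_; _≡ᵇ_)
open import Data.Bool using (Bool; true; false; if_then_else_)
open import Data.Fin using (Fin; punchIn)
open import Data.List using (List; tabulate)
open import Data.List.Relation.Binary.Permutation.Propositional using (_↭_)
open import Data.List.Relation.Binary.Pointwise using (Pointwise)
open import Data.Fin.Permutation using (Permutation′; _⟨$⟩ʳ_)
open import Data.Product using (Σ; _×_)
open import Relation.Binary.PropositionalEquality using (_≡_; cong₂)

record Graph (n : ℕ) : Set where
  field
    adj   : Fin n → Fin n → Bool
    sym   : ∀ i j → adj i j ≡ adj j i
    irrfl : ∀ i → adj i i ≡ false
open Graph public

countTrue : ∀ {n} → (Fin n → Bool) → ℕ
countTrue {zero}  p = 0
countTrue {suc n} p = (if p Fin.zero then 1 else 0) + countTrue (λ i → p (Fin.suc i))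

deg : ∀ {n} → Graph n → Fin n → ℕ
deg G i = countTrue (adj G i)

dcount : ∀ {n} → Graph n → ℕ → ℕ
dcount G s = countTrue (λ i → deg G i ≡ᵇ s)

dcountPred : ∀ {n} → Graph n → ℕ → ℕ
dcountPred G zero    = 0
dcountPred G (suc s) = dcount G s

card : ∀ {m} → Graph (suc m) → Fin (suc m) → Graph m
card G v = record
  { adj   = λ i j → adj G (punchIn v i) (punchIn v j)
  ; sym   = λ i j → sym G (punchIn v i) (punchIn v j)
  ; irrfl = λ i → irrfl G (punchIn v i)
  }

-- graph isomorphism (unlabelled graphs = isomorphism classes)
Iso : ∀ {m} → Graph m → Graph m → Set
Iso {m} G H = Σ (Permutation′ m) λ σ → ∀ i j → adj G i j ≡ adj H (σ ⟨$⟩ʳ i) (σ ⟨$⟩ʳ j)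

SameMultiset : ∀ {m} → List (Graph m) → List (Graph m) → Set
SameMultiset {m} L₁ L₂ = Σ (List (Graph m)) λ L → (L₁ ↭ L) × Pointwise Iso L L₂

cards : ∀ {m r} → Graph (suc m) → (Fin r → Fin (suc m)) → List (Graph m)
cards G v = tabulate (λ i → card G (v i))

-- Deleting a vertex lowers the degree of every other vertex by 0 or 1. Hence
-- if c counts the vertices of a card G - v whose degree is t or t - 1, then
-- d_t - 1 ≤ c ≤ d_{t-1} + d_t + d_{t+1}. Taking for d_t^* the largest such c
-- over the given cards is invariant under isomorphism and reordering, and a
-- single card already yields both bounds, so only n - k ≥ 1 is used (not the
-- distinctness of the v_i).
module Submission where

open import Defs
open import Data.Nat using (ℕ; suc; _*_; _∸_; _≤_; _<_)
open import Data.Fin using (Fin)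
open import Data.List using (List)
open import Data.Integer using (+_)
open import Data.Rational using (ℚ; _/_; 1ℚ) renaming (_+_ to _+ℚ_; _-_ to _-ℚ_; _≤_ to _≤ℚ_)
open import Data.Product using (Σ; _×_)
open import Function.Definitions using (Injective)
open import Relation.Binary.PropositionalEquality using (_≡_)

open import Relation.Binary.PropositionalEquality as ≡ using (refl; trans; cong; cong₂; subst; setoid; module ≡-Reasoning)
open import Algebra.Properties.CommutativeSemigroup using (interchange)
open import Data.Bool using (Bool; true; false; T; _∨_; if_then_else_)
open import Data.Bool.Properties using (T-∨)
open import Data.Empty using (⊥-elim)
open import Data.Fin using (zero; suc; punchIn; fromℕ<)
open import Data.Fin.Permutation using (Permutation′; _⟨$⟩ʳ_)
open import Data.Integer as ℤ using (+≤+; _⊖_)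
import Data.Integer.Properties as ℤ
open import Data.List using (map; foldr)
open import Data.List.Properties using (foldr-preservesᵇ; foldr-preservesᵒ)
open import Data.List.Relation.Binary.Permutation.Propositional using (_↭_; ↭⇒↭ₛ)
import Data.List.Relation.Binary.Permutation.Propositional.Properties as ↭
open import Data.List.Relation.Binary.Permutation.Setoid.Properties (setoid ℕ) using (foldr-commMonoid)
import Data.List.Relation.Binary.Pointwise as Pointwise
open import Data.List.Relation.Unary.All using (All)
import Data.List.Relation.Unary.All.Properties as All
open import Data.List.Relation.Unary.Any using (Any)
import Data.List.Relation.Unary.Any.Properties as Any
open import Data.Nat using (zero; _+_; _⊔_; _≡ᵇ_; z≤n; s≤s)
open import Data.Nat.Properties
  using ( ≤-refl; ≤-reflexive; ≤-trans; <-≤-trans; +-mono-≤; +-monoʳ-≤; m≤n+m; m≤m*n; m<m+n; m<n⇒0<n∸m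
        ; ⊔-lub; m≤n⇒m≤n⊔o; m≤n⇒m≤o⊔n; +-0-commutativeMonoid; +-commutativeSemigroup
        ; ⊔-0-isCommutativeMonoid; +-assoc; module ≤-Reasoning)
open import Data.Product using (_,_; proj₁)
open import Data.Rational.Properties using (toℚᵘ-fromℚᵘ; toℚᵘ-cancel-≤; toℚᵘ-homo-+; toℚᵘ-homo‿-)
open import Data.Rational using (toℚᵘ; -_)
open import Data.Rational.Unnormalised using (mkℚᵘ; ↥_; *≤*) renaming (_≃_ to _≃ᵘ_; _≤_ to _≤ᵘ_)
import Data.Rational.Unnormalised as ℚᵘ
import Data.Rational.Unnormalised.Properties as ℚᵘ
open import Data.Sum using (inj₁; inj₂; [_,_])
open import Function using (_∘_; Equivalence)

import Algebra.Properties.CommutativeMonoid.Sum +-0-commutativeMonoid as ℕΣ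

T-∨-introˡ : ∀ a {b} → T a → T (a ∨ b)
T-∨-introˡ true _ = _

T-∨-introʳ : ∀ a {b} → T b → T (a ∨ b)
T-∨-introʳ false Tb = Tb
T-∨-introʳ true  _  = _

indicator : Bool → ℕ
indicator b = if b then 1 else 0

indicator≤1 : ∀ b → indicator b ≤ 1
indicator≤1 false = z≤n
indicator≤1 true  = ≤-refl

indicator-mono : ∀ {a b} → (T a → T b) → indicator a ≤ indicator b
indicator-mono {false}         _   = z≤n
indicator-mono {true}  {true}  _   = ≤-refl
indicator-mono {true}  {false} a⇒b = ⊥-elim (a⇒b _)

indicator-∨ : ∀ a b → indicator (a ∨ b) ≤ indicator a + indicator b
indicator-∨ false b     = ≤-refl
indicator-∨ true  false = ≤-refl
indicator-∨ true  true  = s≤s z≤n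

countTrue≡sum : ∀ {n} (p : Fin n → Bool) → countTrue p ≡ ℕΣ.sum (indicator ∘ p)
countTrue≡sum {zero}  p = refl
countTrue≡sum {suc n} p = cong (_+_ (indicator (p zero))) (countTrue≡sum (p ∘ suc))

countTrue-cong : ∀ {n} {p q : Fin n → Bool} → (∀ i → p i ≡ q i) → countTrue p ≡ countTrue q
countTrue-cong {zero}  p≗q = refl
countTrue-cong {suc n} p≗q = cong₂ _+_ (cong indicator (p≗q zero)) (countTrue-cong (p≗q ∘ suc))

countTrue-mono : ∀ {n} {p q : Fin n → Bool} → (∀ i → T (p i) → T (q i)) → countTrue p ≤ countTrue q
countTrue-mono {zero}  p⇒q = z≤n
countTrue-mono {suc n} p⇒q = +-mono-≤ (indicator-mono (p⇒q zero)) (countTrue-mono (p⇒q ∘ suc))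

countTrue-∨ : ∀ {n} (p q : Fin n → Bool) → countTrue (λ i → p i ∨ q i) ≤ countTrue p + countTrue q
countTrue-∨ {zero}  p q = z≤n
countTrue-∨ {suc n} p q = ≤-trans
  (+-mono-≤ (indicator-∨ (p zero) (q zero)) (countTrue-∨ (p ∘ suc) (q ∘ suc)))
  (≤-reflexive (interchange +-commutativeSemigroup (indicator (p zero)) _ _ _))

countTrue-punchIn : ∀ {n} (p : Fin (suc n) → Bool) v →
                    countTrue p ≡ indicator (p v) + countTrue (p ∘ punchIn v)
countTrue-punchIn p v = begin
  countTrue p                                           ≡⟨ countTrue≡sum p ⟩
  ℕΣ.sum (indicator ∘ p)                                ≡⟨ ℕΣ.sum-remove (indicator ∘ p) ⟩
  indicator (p v) + ℕΣ.sum (indicator ∘ p ∘ punchIn v)  ≡⟨ cong (_+_ _) (countTrue≡sum (p ∘ punchIn v)) ⟨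
  indicator (p v) + countTrue (p ∘ punchIn v)           ∎
  where open ≡-Reasoning

countTrue-punchIn-≤ : ∀ {n} (p : Fin (suc n) → Bool) v → countTrue (p ∘ punchIn v) ≤ countTrue p
countTrue-punchIn-≤ p v =
  ≤-trans (m≤n+m _ (indicator (p v))) (≤-reflexive (≡.sym (countTrue-punchIn p v)))

countTrue-permute : ∀ {n} (σ : Permutation′ n) (p : Fin n → Bool) →
                    countTrue (p ∘ (σ ⟨$⟩ʳ_)) ≡ countTrue p
countTrue-permute σ p = begin
  countTrue (p ∘ (σ ⟨$⟩ʳ_))           ≡⟨ countTrue≡sum (p ∘ (σ ⟨$⟩ʳ_)) ⟩
  ℕΣ.sum (indicator ∘ p ∘ (σ ⟨$⟩ʳ_))  ≡⟨ ℕΣ.sum-permute (indicator ∘ p) σ ⟨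
  ℕΣ.sum (indicator ∘ p)              ≡⟨ countTrue≡sum p ⟨
  countTrue p                         ∎
  where open ≡-Reasoning

countTrue-false : ∀ n → countTrue {n} (λ _ → false) ≡ 0
countTrue-false zero    = refl
countTrue-false (suc n) = countTrue-false n

deg-card : ∀ {m} (G : Graph (suc m)) v i →
           deg G (punchIn v i) ≡ indicator (adj G (punchIn v i) v) + deg (card G v) i
deg-card G v i = countTrue-punchIn (adj G (punchIn v i)) v

deg-iso : ∀ {m} {G H : Graph m} (I : Iso G H) i → deg G i ≡ deg H (proj₁ I ⟨$⟩ʳ i)
deg-iso {H = H} (σ , adj≡) i =
  trans (countTrue-cong (adj≡ i)) (countTrue-permute σ (adj H (σ ⟨$⟩ʳ i)))

countDeg : ∀ {m} → (ℕ → Bool) → Graph m → ℕ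
countDeg P G = countTrue (P ∘ deg G)

countDeg-iso : ∀ {m} (P : ℕ → Bool) {G H : Graph m} → Iso G H → countDeg P G ≡ countDeg P H
countDeg-iso P {G} {H} I@(σ , _) =
  trans (countTrue-cong (cong P ∘ deg-iso {G = G} {H} I)) (countTrue-permute σ (P ∘ deg H))

-- suc d ≡ᵇ t says d = t - 1; it is false for t = 0, matching d_{-1} = 0.
near : ℕ → ℕ → Bool
near t d = (d ≡ᵇ t) ∨ (suc d ≡ᵇ t)

around : ℕ → ℕ → Bool
around t d = (suc d ≡ᵇ t) ∨ (d ≡ᵇ t) ∨ (d ≡ᵇ suc t)

indicator+d≡t⇒near : ∀ t b d → T (indicator b + d ≡ᵇ t) → T (near t d)
indicator+d≡t⇒near t false d d≡t   = T-∨-introˡ (d ≡ᵇ t) d≡t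
indicator+d≡t⇒near t true  d 1+d≡t = T-∨-introʳ (d ≡ᵇ t) 1+d≡t

near⇒around-indicator+d : ∀ t b d → T (near t d) → T (around t (indicator b + d))
near⇒around-indicator+d t b d near-t with Equivalence.to (T-∨ {d ≡ᵇ t}) near-t | b
... | inj₁ d≡t   | false = T-∨-introʳ (suc d ≡ᵇ t) (T-∨-introˡ (d ≡ᵇ t) d≡t)
... | inj₁ d≡t   | true  = T-∨-introʳ (suc (suc d) ≡ᵇ t) (T-∨-introʳ (suc d ≡ᵇ t) d≡t)
... | inj₂ 1+d≡t | false = T-∨-introˡ (suc d ≡ᵇ t) 1+d≡t
... | inj₂ 1+d≡t | true  = T-∨-introʳ (suc (suc d) ≡ᵇ t) (T-∨-introˡ (suc d ≡ᵇ t) 1+d≡t)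

countDeg-suc≡dcountPred : ∀ {n} (G : Graph n) t → countDeg (λ d → suc d ≡ᵇ t) G ≡ dcountPred G t
countDeg-suc≡dcountPred {n} G zero    = countTrue-false n
countDeg-suc≡dcountPred     G (suc t) = refl

countDeg-around : ∀ {n} (G : Graph n) t →
                  countDeg (around t) G ≤ dcountPred G t + dcount G t + dcount G (suc t)
countDeg-around G t = begin
  countDeg (around t) G
    ≤⟨ countTrue-∨ (pred-t ∘ deg G) _ ⟩
  countDeg pred-t G + countDeg (λ d → (d ≡ᵇ t) ∨ (d ≡ᵇ suc t)) G
    ≤⟨ +-monoʳ-≤ (countDeg pred-t G) (countTrue-∨ ((_≡ᵇ t) ∘ deg G) ((_≡ᵇ suc t) ∘ deg G)) ⟩
  countDeg pred-t G + (dcount G t + dcount G (suc t))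
    ≡⟨ cong (_+ (dcount G t + dcount G (suc t))) (countDeg-suc≡dcountPred G t) ⟩
  dcountPred G t + (dcount G t + dcount G (suc t))
    ≡⟨ +-assoc (dcountPred G t) _ _ ⟨
  dcountPred G t + dcount G t + dcount G (suc t)
    ∎
  where
  open ≤-Reasoning
  pred-t : ℕ → Bool
  pred-t d = suc d ≡ᵇ t

dcount≤1+countDeg-near-card : ∀ {m} (G : Graph (suc m)) t v →
                              dcount G t ≤ suc (countDeg (near t) (card G v))
dcount≤1+countDeg-near-card G t v = begin
  dcount G t
    ≡⟨ countTrue-punchIn ((_≡ᵇ t) ∘ deg G) v ⟩
  indicator (deg G v ≡ᵇ t) + countTrue (λ i → deg G (punchIn v i) ≡ᵇ t)
    ≤⟨ +-mono-≤ (indicator≤1 _) (countTrue-mono degree-t⇒near) ⟩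
  1 + countDeg (near t) (card G v)
    ∎
  where
  open ≤-Reasoning
  degree-t⇒near : ∀ i → T (deg G (punchIn v i) ≡ᵇ t) → T (near t (deg (card G v) i))
  degree-t⇒near i = indicator+d≡t⇒near t (adj G (punchIn v i) v) (deg (card G v) i)
                  ∘ subst (T ∘ (_≡ᵇ t)) (deg-card G v i)

countDeg-near-card≤countDeg-around : ∀ {m} (G : Graph (suc m)) t v →
                                     countDeg (near t) (card G v) ≤ countDeg (around t) G
countDeg-near-card≤countDeg-around G t v = begin
  countDeg (near t) (card G v)                ≤⟨ countTrue-mono near⇒around ⟩
  countTrue (around t ∘ deg G ∘ punchIn v)    ≤⟨ countTrue-punchIn-≤ (around t ∘ deg G) v ⟩
  countDeg (around t) G                       ∎
  where
  open ≤-Reasoning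
  near⇒around : ∀ i → T (near t (deg (card G v) i)) → T (around t (deg G (punchIn v i)))
  near⇒around i = subst (T ∘ around t) (≡.sym (deg-card G v i))
                ∘ near⇒around-indicator+d t (adj G (punchIn v i) v) (deg (card G v) i)

maximum : List ℕ → ℕ
maximum = foldr _⊔_ 0

maximum-↭ : ∀ {xs ys} → xs ↭ ys → maximum xs ≡ maximum ys
maximum-↭ = foldr-commMonoid ⊔-0-isCommutativeMonoid ∘ ↭⇒↭ₛ

≤-maximum : ∀ {x xs} → Any (x ≤_) xs → x ≤ maximum xs
≤-maximum = foldr-preservesᵒ (λ a b → [ m≤n⇒m≤n⊔o b , m≤n⇒m≤o⊔n a ]) 0 _ ∘ inj₂

maximum-≤ : ∀ {b xs} → All (_≤ b) xs → maximum xs ≤ b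
maximum-≤ = foldr-preservesᵇ ⊔-lub z≤n

maxNear : ∀ {m} → ℕ → List (Graph m) → ℕ
maxNear t = maximum ∘ map (countDeg (near t))

maxNear-resp-SameMultiset : ∀ {m} t {L₁ L₂ : List (Graph m)} →
                            SameMultiset L₁ L₂ → maxNear t L₁ ≡ maxNear t L₂
maxNear-resp-SameMultiset t (L , L₁↭L , L≅L₂) = trans
  (maximum-↭ (↭.map⁺ (countDeg (near t)) L₁↭L))
  (cong maximum (Pointwise.Pointwise-≡⇒≡ (Pointwise.map⁺ _ _
    (Pointwise.map (λ {G} {H} → countDeg-iso (near t) {G} {H}) L≅L₂))))

dcount≤1+maxNear : ∀ {m r} (G : Graph (suc m)) t (v : Fin r → Fin (suc m)) i →
                   dcount G t ≤ suc (maxNear t (cards G v))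
dcount≤1+maxNear G t v i = ≤-trans (dcount≤1+countDeg-near-card G t (v i))
                                   (s≤s (≤-maximum (Any.map⁺ (Any.tabulate⁺ i ≤-refl))))

maxNear≤dcounts : ∀ {m r} (G : Graph (suc m)) t (v : Fin r → Fin (suc m)) →
                  maxNear t (cards G v) ≤ dcountPred G t + dcount G t + dcount G (suc t)
maxNear≤dcounts G t v = maximum-≤ (All.map⁺ (All.tabulate⁺ λ i →
  ≤-trans (countDeg-near-card≤countDeg-around G t (v i)) (countDeg-around G t)))

toℚᵘ-/suc : ∀ i n → toℚᵘ (i / suc n) ≃ᵘ mkℚᵘ i n
toℚᵘ-/suc i n = toℚᵘ-fromℚᵘ (mkℚᵘ i n)

toℚᵘ-cancel-≤-≃ : ∀ {p q p′ q′} → toℚᵘ p ≃ᵘ p′ → toℚᵘ q ≃ᵘ q′ → p′ ≤ᵘ q′ → p ≤ℚ q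
toℚᵘ-cancel-≤-≃ p≃ q≃ = toℚᵘ-cancel-≤ ∘ ℚᵘ.≤-respˡ-≃ (ℚᵘ.≃-sym p≃) ∘ ℚᵘ.≤-respʳ-≃ (ℚᵘ.≃-sym q≃)

x≤a+b+c⇒x≤ᵘa+b+c : ∀ {x} a b c → x ≤ a + b + c →
                   mkℚᵘ (+ x) 0 ≤ᵘ mkℚᵘ (+ a) 0 ℚᵘ.+ mkℚᵘ (+ b) 0 ℚᵘ.+ mkℚᵘ (+ c) 0
x≤a+b+c⇒x≤ᵘa+b+c {x} a b c x≤a+b+c = *≤* (begin
  + x ℤ.* + 1           ≡⟨ ℤ.*-identityʳ (+ x) ⟩
  + x                   ≤⟨ +≤+ x≤a+b+c ⟩
  + a ℤ.+ + b ℤ.+ + c   ≡⟨ numerator ⟨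
  ↥ S                   ≡⟨ ℤ.*-identityʳ (↥ S) ⟨
  ↥ S ℤ.* + 1           ∎)
  where
  open ℤ.≤-Reasoning
  S = mkℚᵘ (+ a) 0 ℚᵘ.+ mkℚᵘ (+ b) 0 ℚᵘ.+ mkℚᵘ (+ c) 0
  numerator : ↥ S ≡ + a ℤ.+ + b ℤ.+ + c
  numerator rewrite ℤ.*-identityʳ (+ a) | ℤ.*-identityʳ (+ b) | ℤ.*-identityʳ (+ c)
                  | ℤ.*-identityʳ (+ a ℤ.+ + b) = refl

d≤1+x⇒d/4-1≤ᵘx : ∀ {d} x → d ≤ suc x → mkℚᵘ (+ d) 3 ℚᵘ.- mkℚᵘ (+ 1) 0 ≤ᵘ mkℚᵘ (+ x) 0
d≤1+x⇒d/4-1≤ᵘx {d} x d≤1+x = *≤* (begin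
  ↥ L ℤ.* + 1           ≡⟨ ℤ.*-identityʳ (↥ L) ⟩
  ↥ L                   ≡⟨ cong (ℤ._+ ℤ.-[1+ 3 ]) (ℤ.*-identityʳ (+ d)) ⟩
  d ⊖ 4                 ≤⟨ ℤ.⊖-monoˡ-≤ 4 (≤-trans d≤1+x 1+x≤4+4x) ⟩
  (4 + x * 4) ⊖ 4       ≡⟨ ℤ.pos-* x 4 ⟩
  + x ℤ.* + 4           ∎)
  where
  open ℤ.≤-Reasoning
  L = mkℚᵘ (+ d) 3 ℚᵘ.- mkℚᵘ (+ 1) 0
  1+x≤4+4x : suc x ≤ 4 + x * 4
  1+x≤4+4x = +-mono-≤ {1} {4} (s≤s z≤n) (m≤m*n x 4)

x≤a+b+c⇒x/1≤a/1+b/1+c/1 : ∀ {x} a b c → x ≤ a + b + c →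
                  (+ x) / 1 ≤ℚ (+ a) / 1 +ℚ (+ b) / 1 +ℚ (+ c) / 1
x≤a+b+c⇒x/1≤a/1+b/1+c/1 a b c x≤a+b+c =
  toℚᵘ-cancel-≤-≃ (toℚᵘ-/suc _ 0) sum≃ (x≤a+b+c⇒x≤ᵘa+b+c a b c x≤a+b+c)
  where
  a+b≃ = ℚᵘ.≃-trans (toℚᵘ-homo-+ ((+ a) / 1) ((+ b) / 1))
                    (ℚᵘ.+-cong (toℚᵘ-/suc (+ a) 0) (toℚᵘ-/suc (+ b) 0))
  sum≃ = ℚᵘ.≃-trans (toℚᵘ-homo-+ ((+ a) / 1 +ℚ (+ b) / 1) ((+ c) / 1))
                    (ℚᵘ.+-cong a+b≃ (toℚᵘ-/suc (+ c) 0))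

d≤1+x⇒d/4-1≤x : ∀ {d} x → d ≤ suc x → (+ d) / 4 -ℚ 1ℚ ≤ℚ (+ x) / 1
d≤1+x⇒d/4-1≤x {d} x d≤1+x =
  toℚᵘ-cancel-≤-≃ difference≃ (toℚᵘ-/suc _ 0) (d≤1+x⇒d/4-1≤ᵘx x d≤1+x)
  where
  difference≃ = ℚᵘ.≃-trans (toℚᵘ-homo-+ ((+ d) / 4) (- 1ℚ))
                  (ℚᵘ.+-cong (toℚᵘ-/suc (+ d) 3) (toℚᵘ-homo‿- 1ℚ))

k<1+m : ∀ {m k} → 3 * k ≤ suc m → k < suc m
k<1+m {k = zero}  _      = s≤s z≤n
k<1+m {k = suc k} 3k≤1+m = <-≤-trans (m<m+n (suc k) (s≤s z≤n)) 3k≤1+m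

lemma5 : (m k t : ℕ) → 3 * k ≤ suc m → t < suc m →
    Σ (List (Graph m) → ℚ) λ f →
      (∀ L₁ L₂ → SameMultiset L₁ L₂ → f L₁ ≡ f L₂) ×
      (∀ (G : Graph (suc m)) (v : Fin (suc m ∸ k) → Fin (suc m)) → Injective _≡_ _≡_ v →
        (((+ dcount G t) / 4) -ℚ 1ℚ ≤ℚ f (cards G v)) ×
        (f (cards G v) ≤ℚ ((+ (dcountPred G t)) / 1) +ℚ ((+ dcount G t) / 1) +ℚ ((+ dcount G (suc t)) / 1)))
lemma5 m k t 3k≤1+m _ =
  (λ L → + maxNear t L / 1) ,
  (λ _ _ same → cong (λ c → + c / 1) (maxNear-resp-SameMultiset t same)) ,
  λ G v _ →
    d≤1+x⇒d/4-1≤x _ (dcount≤1+maxNear G t v i₀) ,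
    x≤a+b+c⇒x/1≤a/1+b/1+c/1 (dcountPred G t) (dcount G t) (dcount G (suc t)) (maxNear≤dcounts G t v)
  where
  i₀ : Fin (suc m ∸ k)
  i₀ = fromℕ< (m<n⇒0<n∸m (k<1+m {m} {k} 3k≤1+m))
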